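{- Let $p\geq 1$ and $q\geq p-1$ be integers. Then there exists an isolation matrix $F_{p,q}$ of size $(p+q)\times(p+q)$ such that every column of $F_{p,q}$ contains exactly $p$ ones and $q$ zeros.
   Context: An isolation matrix is a square Boolean matrix $F$ whose diagonal entries are all $1$ and such that for every $i\neq j$, $F[i][j]=0$ or $F[j][i]=0$ (so the diagonal entries form an isolation set: no two of them lie in a common $2\times 2$ all-ones submatrix). -}

module Defs where

open import Data.Nat using (ℕ; zero; suc; _+_)
open import Data.Bool using (Bool; true; false)
open import Data.Fin using (Fin)
open import Data.Product using (_×_)
open import Data.Sum using (_⊎_)
open import Relation.Binary.PropositionalEquality using (_≡_; _≢_)

BoolMatrix : ℕ → Set
BoolMatrix n = Fin n → Fin n → Bool

count : ∀ {m} → Bool → (Fin m → Bool) → ℕ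
count {zero}  b f = 0
count {suc m} b f with f Fin.zero | b
... | true  | true  = suc (count b (λ i → f (Fin.suc i)))
... | false | false = suc (count b (λ i → f (Fin.suc i)))
... | true  | false = count b (λ i → f (Fin.suc i))
... | false | true  = count b (λ i → f (Fin.suc i))

IsIsolationMatrix : ∀ {n} → BoolMatrix n → Set
IsIsolationMatrix {n} F =
  ((i : Fin n) → F i i ≡ true) ×
  ((i j : Fin n) → i ≢ j → (F i j ≡ false) ⊎ (F j i ≡ false))

onesInColumn : ∀ {n} → BoolMatrix n → Fin n → ℕ
onesInColumn F j = count true (λ i → F i j)

zerosInColumn : ∀ {n} → BoolMatrix n → Fin n → ℕ
zerosInColumn F j = count false (λ i → F i j)

module Submission where

open import Defs
open import Data.Nat using (ℕ; _+_; _≤_; _∸_)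
open import Data.Product using (Σ; _×_)
open import Relation.Binary.PropositionalEquality using (_≡_)

open import Data.Nat using (zero; suc; _<_; _⊓_; s≤s; _≤?_; _<?_)
open import Data.Nat.Properties
open import Data.Bool using (Bool; true; false; if_then_else_)
open import Data.Fin using (Fin; toℕ)
open import Data.Fin.Properties using (toℕ-injective; toℕ<n)
open import Data.Product using (_,_)
open import Data.Sum using (_⊎_; inj₁; inj₂)
open import Data.Empty using (⊥-elim)
open import Function using (_∘_)
open import Relation.Nullary using (yes; no; does)
open import Relation.Nullary.Decidable using (dec-true; dec-false)
open import Relation.Binary using (tri<; tri≈; tri>)
open import Relation.Binary.PropositionalEquality
  using (_≢_; refl; sym; trans; cong; cong₂; module ≡-Reasoning)

-- The matrix is the circulant band F i j = 1 iff (i - j) mod n < p, n = p + q: column j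
-- has its ones in the p cyclically consecutive rows j, j + 1, …, j + p - 1.  For i ≠ j the
-- offsets (i - j) mod n and (j - i) mod n add up to n, and n ≥ 2p - 1 forbids both
-- being below p.

countℕ : ℕ → (ℕ → Bool) → ℕ
countℕ zero    g = 0
countℕ (suc m) g = if g 0 then suc (countℕ m (g ∘ suc)) else countℕ m (g ∘ suc)

count-true-toℕ : ∀ m (g : ℕ → Bool) → count true (λ (i : Fin m) → g (toℕ i)) ≡ countℕ m g
count-true-toℕ zero    g = refl
count-true-toℕ (suc m) g with g 0
... | true  = cong suc (count-true-toℕ m (g ∘ suc))
... | false = count-true-toℕ m (g ∘ suc)

count-true+count-false : ∀ m (f : Fin m → Bool) → count true f + count false f ≡ m
count-true+count-false zero    f = refl
count-true+count-false (suc m) f with f Fin.zero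
... | true  = cong suc (count-true+count-false m (f ∘ Fin.suc))
... | false = trans (+-suc (count true (f ∘ Fin.suc)) _)
                    (cong suc (count-true+count-false m (f ∘ Fin.suc)))

countℕ-cong : ∀ m {g h : ℕ → Bool} → (∀ i → i < m → g i ≡ h i) → countℕ m g ≡ countℕ m h
countℕ-cong zero    g≗h = refl
countℕ-cong (suc m) {g} {h} g≗h with g 0 | h 0 | g≗h 0 (s≤s _≤_.z≤n)
... | true  | true  | refl = cong suc (countℕ-cong m (λ i i<m → g≗h (suc i) (s≤s i<m)))
... | false | false | refl = countℕ-cong m (λ i i<m → g≗h (suc i) (s≤s i<m))

countℕ-+ : ∀ a b g → countℕ (a + b) g ≡ countℕ a g + countℕ b (λ k → g (a + k))
countℕ-+ zero    b g = refl
countℕ-+ (suc a) b g with g 0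
... | true  = cong suc (countℕ-+ a b (g ∘ suc))
... | false = countℕ-+ a b (g ∘ suc)

countℕ-false : ∀ m → countℕ m (λ _ → false) ≡ 0
countℕ-false zero    = refl
countℕ-false (suc m) = countℕ-false m

countℕ-< : ∀ m c → countℕ m (λ i → does (i <? c)) ≡ m ⊓ c
countℕ-< zero    c       = refl
countℕ-< (suc m) zero    = countℕ-false m
countℕ-< (suc m) (suc c) = cong suc (countℕ-< m c)

-- For i, j ≤ n this is (i - j) mod n, computed without division.
offset : ℕ → ℕ → ℕ → ℕ
offset n i j with j ≤? i
... | yes _ = i ∸ j
... | no  _ = n ∸ j + i

offset-≥ : ∀ n {i j} → j ≤ i → offset n i j ≡ i ∸ j
offset-≥ n {i} {j} j≤i with j ≤? i
... | yes _   = refl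
... | no  j≰i = ⊥-elim (j≰i j≤i)

offset-< : ∀ n {i j} → i < j → offset n i j ≡ n ∸ j + i
offset-< n {i} {j} i<j with j ≤? i
... | yes j≤i = ⊥-elim (<⇒≱ i<j j≤i)
... | no  _   = refl

offset-+ : ∀ n j k → offset n (j + k) j ≡ k
offset-+ n j k = trans (offset-≥ n (m≤m+n j k)) (m+n∸m≡n j k)

offset-diag : ∀ n i → offset n i i ≡ 0
offset-diag n i = trans (offset-≥ n (≤-refl {i})) (n∸n≡0 i)

offset-+-offset-< : ∀ n {i j} → i < j → j ≤ n → offset n i j + offset n j i ≡ n
offset-+-offset-< n {i} {j} i<j j≤n = begin
  offset n i j + offset n j i ≡⟨ cong₂ _+_ (offset-< n i<j) (offset-≥ n (<⇒≤ i<j)) ⟩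
  n ∸ j + i + (j ∸ i)         ≡⟨ +-assoc (n ∸ j) i (j ∸ i) ⟩
  n ∸ j + (i + (j ∸ i))       ≡⟨ cong (n ∸ j +_) (m+[n∸m]≡n (<⇒≤ i<j)) ⟩
  n ∸ j + j                   ≡⟨ m∸n+n≡m j≤n ⟩
  n                           ∎
  where open ≡-Reasoning

offset-+-offset : ∀ n {i j} → i ≢ j → i ≤ n → j ≤ n → offset n i j + offset n j i ≡ n
offset-+-offset n {i} {j} i≢j i≤n j≤n with <-cmp i j
... | tri< i<j _ _ = offset-+-offset-< n i<j j≤n
... | tri≈ _ i≡j _ = ⊥-elim (i≢j i≡j)
... | tri> _ _ j<i = trans (+-comm (offset n i j) _) (offset-+-offset-< n j<i i≤n)

band : ℕ → ℕ → ℕ → ℕ → Bool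
band n p i j = does (offset n i j <? p)

band-diag : ∀ n p i → 0 < p → band n p i i ≡ true
band-diag n p i 0<p = trans (cong (λ o → does (o <? p)) (offset-diag n i)) (dec-true (0 <? p) 0<p)

band-isolated : ∀ n p {i j} → p + p ≤ suc n → i ≢ j → i ≤ n → j ≤ n →
                band n p i j ≡ false ⊎ band n p j i ≡ false
band-isolated n p {i} {j} 2p≤1+n i≢j i≤n j≤n with offset n i j <? p | offset n j i <? p
... | no  a | _     = inj₁ (dec-false (offset n i j <? p) a)
... | yes _ | no  b = inj₂ (dec-false (offset n j i <? p) b)
... | yes a | yes b = ⊥-elim (<-irrefl refl (begin-strict
  suc n                                   <⟨ n<1+n (suc n) ⟩
  suc (suc n)                             ≡⟨ cong (suc ∘ suc) (sym (offset-+-offset n i≢j i≤n j≤n)) ⟩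
  suc (suc (offset n i j + offset n j i)) ≡⟨ cong suc (sym (+-suc (offset n i j) _)) ⟩
  suc (offset n i j) + suc (offset n j i) ≤⟨ +-mono-≤ a b ⟩
  p + p                                   ≤⟨ 2p≤1+n ⟩
  suc n                                   ∎))
  where open ≤-Reasoning

-- Rotating the column by n ∸ j rows turns it into the initial segment {0, …, p - 1}.
countℕ-band-column : ∀ n p j → p ≤ n → j ≤ n → countℕ n (λ i → band n p i j) ≡ p
countℕ-band-column n p j p≤n j≤n = begin
  countℕ n column                                        ≡⟨ cong (λ m → countℕ m column) (sym j+r≡n) ⟩
  countℕ (j + r) column                                  ≡⟨ countℕ-+ j r column ⟩
  countℕ j column + countℕ r (λ k → column (j + k))      ≡⟨ cong₂ _+_ (countℕ-cong j above) (countℕ-cong r below) ⟩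
  countℕ j (λ i → initial (r + i)) + countℕ r initial    ≡⟨ +-comm (countℕ j _) _ ⟩
  countℕ r initial + countℕ j (λ i → initial (r + i))    ≡⟨ sym (countℕ-+ r j initial) ⟩
  countℕ (r + j) initial                                 ≡⟨ countℕ-< (r + j) p ⟩
  (r + j) ⊓ p                                            ≡⟨ m≥n⇒m⊓n≡n p≤r+j ⟩
  p                                                      ∎
  where
  open ≡-Reasoning
  r : ℕ
  r = n ∸ j
  j+r≡n : j + r ≡ n
  j+r≡n = m+[n∸m]≡n j≤n
  p≤r+j : p ≤ r + j
  p≤r+j = ≤-trans p≤n (≤-reflexive (trans (sym j+r≡n) (+-comm j r)))
  column initial : ℕ → Bool
  column i = band n p i j
  initial k = does (k <? p)
  above : ∀ i → i < j → column i ≡ initial (r + i)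
  above i i<j = cong initial (offset-< n i<j)
  below : ∀ k → k < r → column (j + k) ≡ initial k
  below k _ = cong initial (offset-+ n j k)

p+p≤suc[p+q] : ∀ p q → 1 ≤ p → p ∸ 1 ≤ q → p + p ≤ suc (p + q)
p+p≤suc[p+q] (suc p) q _ p≤q = s≤s (begin
  p + suc p   ≡⟨ +-suc p p ⟩
  suc (p + p) ≤⟨ s≤s (+-monoʳ-≤ p p≤q) ⟩
  suc (p + q) ∎)
  where open ≤-Reasoning

claim4 : (p q : ℕ) → 1 ≤ p → p ∸ 1 ≤ q →
    Σ (BoolMatrix (p + q)) (λ F →
    IsIsolationMatrix F ×
    ((j : _) → (onesInColumn F j ≡ p) × (zerosInColumn F j ≡ q)))
claim4 p q 1≤p p∸1≤q = F , (diagonal , isolated) , λ j → ones j , zeros j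
  where
  n : ℕ
  n = p + q
  F : BoolMatrix n
  F i j = band n p (toℕ i) (toℕ j)
  ≤n : (i : Fin n) → toℕ i ≤ n
  ≤n i = <⇒≤ (toℕ<n i)
  diagonal : (i : Fin n) → F i i ≡ true
  diagonal i = band-diag n p (toℕ i) 1≤p
  isolated : (i j : Fin n) → i ≢ j → F i j ≡ false ⊎ F j i ≡ false
  isolated i j i≢j = band-isolated n p (p+p≤suc[p+q] p q 1≤p p∸1≤q)
                       (i≢j ∘ toℕ-injective) (≤n i) (≤n j)
  ones : (j : Fin n) → onesInColumn F j ≡ p
  ones j = trans (count-true-toℕ n (λ i → band n p i (toℕ j)))
                 (countℕ-band-column n p (toℕ j) (m≤m+n p q) (≤n j))
  zeros : (j : Fin n) → zerosInColumn F j ≡ q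
  zeros j = +-cancelˡ-≡ p _ q (trans (cong (_+ zerosInColumn F j) (sym (ones j)))
                                     (count-true+count-false n (λ i → F i j)))
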